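{- For every $n$PC formula $H$ and every $\pi\in S_n$, $H^\pi\sim q(H,\mathsf e_{\pi(1)},\dots,\mathsf e_{\pi(n)})$.
   Context: Fix $n\ge 2$, write $\hat n=\{1,\dots,n\}$, let $S_n$ be the group of permutations of $\hat n$ and $V$ a countable set of propositional variables. Formulas of $n$PC are: decorated variables $X^\pi$ ($X\in V$, $\pi\in S_n$); constants $\mathsf e_1,\dots,\mathsf e_n$; compound formulas $q(F,G_1,\dots,G_n)$. For $\rho\in S_n$, $F^\rho$ is defined by $(X^\pi)^\rho=X^{\rho\circ\pi}$, $(\mathsf e_k)^\rho=\mathsf e_{\rho(k)}$, $q(F,G_1,\dots,G_n)^\rho=q(F,G_1^\rho,\dots,G_n^\rho)$. $(ij)$ denotes the transposition exchanging $i$ and $j$ (identity if $i=j$). Contexts $\Gamma,\Delta$ are finite multisets of formulas, $\Gamma^\rho$ elementwise. Sequents $\Gamma\vdash_i\Delta$ ($i\in\hat n$) are provable if derivable by the rules (premises $\Rightarrow$ conclusion), for all $i,j,k\in\hat n$: (Const) $\Rightarrow\ \vdash_i\mathsf e_i$. (Id) $\Rightarrow X^\pi\vdash_i X^\rho$ whenever $\pi^{ -1}(i)=\rho^{ -1}(i)$. (Sym) $\Gamma^{(ij)}\vdash_i\Delta^{(ij)}\Rightarrow\Gamma\vdash_j\Delta$. (Neg1) if $i\ne k$: $\Gamma^{(ij)}\vdash_i F,\Delta^{(ij)}\Rightarrow \Gamma,F^{(jk)}\vdash_j\Delta$. (Neg2) if $j\neq k$: $\Gamma^{(ij)}\vdash_i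 F,\Delta^{(ij)}\Rightarrow \Gamma,F^{(ik)}\vdash_j\Delta$. (Neg3) $\{\Gamma^{(ij)},F\vdash_i\Delta^{(ij)}\}_{i\neq j}\Rightarrow\Gamma\vdash_j F,\Delta$. (qL) $\{\Gamma^{(ji)},F,G_j^{(ji)}\vdash_j\Delta^{(ji)}\}_{j\in\hat n}\Rightarrow \Gamma,q(F,G_1,\dots,G_n)\vdash_i\Delta$. (qR) $\{\Gamma^{(ji)},F\vdash_j G_j^{(ji)},\Delta^{(ji)}\}_{j\in\hat n}\Rightarrow\Gamma\vdash_i q(F,G_1,\dots,G_n),\Delta$. (Cut) $\Gamma,F\vdash_i\Delta$ and $\Gamma\vdash_i F,\Delta\Rightarrow\Gamma\vdash_i\Delta$. Left and right weakening and contraction in each $\vdash_i$. $F\sim G$ means: for every $i\in\hat n$, both $F\vdash_i G$ and $G\vdash_i F$ are provable. -}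

module Defs where

open import Data.Nat using (ℕ)
open import Data.Fin using (Fin)
open import Data.Fin.Permutation.Components as PC using ()
open import Data.Vec using (Vec; lookup; tabulate; []; _∷_)
open import Data.Vec.Properties using (lookup∘tabulate)
open import Data.List using (List; map; [_]) renaming ([] to []ˡ; _∷_ to _∷ˡ_)
open import Data.List.Relation.Binary.Permutation.Propositional using (_↭_)
open import Data.Product using (_×_)
open import Relation.Binary.PropositionalEquality using (_≡_; _≢_; trans; cong)

-- A permutation is stored by its value
-- table and the table of its inverse (proofs irrelevant), so that two
-- permutations are propositionally equal iff they are equal as maps.

record Perm (n : ℕ) : Set where
  constructor perm
  field
    to    : Vec (Fin n) n
    from  : Vec (Fin n) n
    .left  : ∀ k → lookup from (lookup to k) ≡ k
    .right : ∀ k → lookup to (lookup from k) ≡ k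

open Perm public

app : ∀ {n} → Perm n → Fin n → Fin n
app π k = lookup (to π) k

inv : ∀ {n} → Perm n → Fin n → Fin n
inv π k = lookup (from π) k

_∘ₚ_ : ∀ {n} → Perm n → Perm n → Perm n
perm ρt ρf ρl ρr ∘ₚ perm πt πf πl πr = perm
  (tabulate (λ k → lookup ρt (lookup πt k)))
  (tabulate (λ k → lookup πf (lookup ρf k)))
  (λ k → trans (lookup∘tabulate (λ k → lookup πf (lookup ρf k)) _)
         (trans (cong (λ x → lookup πf (lookup ρf x)) (lookup∘tabulate (λ k → lookup ρt (lookup πt k)) k))
         (trans (cong (lookup πf) (ρl (lookup πt k))) (πl k))))
  (λ k → trans (lookup∘tabulate (λ k → lookup ρt (lookup πt k)) _)
         (trans (cong (λ x → lookup ρt (lookup πt x)) (lookup∘tabulate (λ k → lookup πf (lookup ρf k)) k))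
         (trans (cong (lookup ρt) (πr (lookup ρf k))) (ρr k))))

tr : ∀ {n} → Fin n → Fin n → Perm n
tr i j = record
  { to    = tabulate (PC.transpose i j)
  ; from  = tabulate (PC.transpose j i)
  ; left  = λ k → trans (lookup∘tabulate (PC.transpose j i) _)
                  (trans (cong (PC.transpose j i) (lookup∘tabulate (PC.transpose i j) k))
                         (PC.transpose-inverse j i))
  ; right = λ k → trans (lookup∘tabulate (PC.transpose i j) _)
                  (trans (cong (PC.transpose i j) (lookup∘tabulate (PC.transpose j i) k))
                         (PC.transpose-inverse i j))
  }

data Formula (n : ℕ) : Set where
  var : ℕ → Perm n → Formula n                       -- X^π
  e   : Fin n → Formula n
  q   : Formula n → Vec (Formula n) n → Formula n

mutual
  _^_ : ∀ {n} → Formula n → Perm n → Formula n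
  var X π ^ ρ = var X (ρ ∘ₚ π)
  e k     ^ ρ = e (app ρ k)
  q F Gs  ^ ρ = q F (Gs ^ᵛ ρ)

  _^ᵛ_ : ∀ {n m} → Vec (Formula n) m → Perm n → Vec (Formula n) m
  []       ^ᵛ ρ = []
  (G ∷ Gs) ^ᵛ ρ = (G ^ ρ) ∷ (Gs ^ᵛ ρ)

-- contexts: finite multisets, represented as lists up to permutation
-- (exchange rules below)
Ctx : ℕ → Set
Ctx n = List (Formula n)

_^ᶜ_ : ∀ {n} → Ctx n → Perm n → Ctx n
Γ ^ᶜ ρ = map (_^ ρ) Γ

infix 4 _⊢[_]_

data _⊢[_]_ {n : ℕ} : Ctx n → Fin n → Ctx n → Set where
  Const : ∀ {i} → []ˡ ⊢[ i ] [ e i ]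
  Id    : ∀ {i X π ρ} → inv π i ≡ inv ρ i → [ var X π ] ⊢[ i ] [ var X ρ ]
  Sym   : ∀ {i j Γ Δ} → Γ ^ᶜ tr i j ⊢[ i ] Δ ^ᶜ tr i j → Γ ⊢[ j ] Δ
  Neg1  : ∀ {i j k Γ Δ F} → i ≢ k →
          Γ ^ᶜ tr i j ⊢[ i ] F ∷ˡ (Δ ^ᶜ tr i j) →
          (F ^ tr j k) ∷ˡ Γ ⊢[ j ] Δ
  Neg2  : ∀ {i j k Γ Δ F} → j ≢ k →
          Γ ^ᶜ tr i j ⊢[ i ] F ∷ˡ (Δ ^ᶜ tr i j) →
          (F ^ tr i k) ∷ˡ Γ ⊢[ j ] Δ
  Neg3  : ∀ {j Γ Δ F} →
          (∀ i → i ≢ j → F ∷ˡ (Γ ^ᶜ tr i j) ⊢[ i ] Δ ^ᶜ tr i j) →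
          Γ ⊢[ j ] F ∷ˡ Δ
  qL    : ∀ {i Γ Δ F Gs} →
          (∀ j → F ∷ˡ (lookup Gs j ^ tr j i) ∷ˡ (Γ ^ᶜ tr j i) ⊢[ j ] Δ ^ᶜ tr j i) →
          q F Gs ∷ˡ Γ ⊢[ i ] Δ
  qR    : ∀ {i Γ Δ F Gs} →
          (∀ j → F ∷ˡ (Γ ^ᶜ tr j i) ⊢[ j ] (lookup Gs j ^ tr j i) ∷ˡ (Δ ^ᶜ tr j i)) →
          Γ ⊢[ i ] q F Gs ∷ˡ Δ
  Cut   : ∀ {i Γ Δ F} → F ∷ˡ Γ ⊢[ i ] Δ → Γ ⊢[ i ] F ∷ˡ Δ → Γ ⊢[ i ] Δ
  WL    : ∀ {i Γ Δ F} → Γ ⊢[ i ] Δ → F ∷ˡ Γ ⊢[ i ] Δ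
  WR    : ∀ {i Γ Δ F} → Γ ⊢[ i ] Δ → Γ ⊢[ i ] F ∷ˡ Δ
  CL    : ∀ {i Γ Δ F} → F ∷ˡ F ∷ˡ Γ ⊢[ i ] Δ → F ∷ˡ Γ ⊢[ i ] Δ
  CR    : ∀ {i Γ Δ F} → Γ ⊢[ i ] F ∷ˡ F ∷ˡ Δ → Γ ⊢[ i ] F ∷ˡ Δ
  ExL   : ∀ {i Γ Γ' Δ} → Γ ↭ Γ' → Γ ⊢[ i ] Δ → Γ' ⊢[ i ] Δ
  ExR   : ∀ {i Γ Δ Δ'} → Δ ↭ Δ' → Γ ⊢[ i ] Δ → Γ ⊢[ i ] Δ'

_∼_ : ∀ {n} → Formula n → Formula n → Set
F ∼ G = ∀ i → ([ F ] ⊢[ i ] [ G ]) × ([ G ] ⊢[ i ] [ F ])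

-- The sequent ⊢ₘ sees a decoration only through its value at m: by induction on H,
-- H^σ ⊢ₘ H^τ when σ⁻¹(m) = τ⁻¹(m), and H^σ, H^τ ⊢ₘ is derivable (by Neg1) otherwise.
-- Unfolding q(H, e_{π(1)}, …, e_{π(n)}) at index i by qL/qR leaves, for each j, the
-- constant e_{(j i)(π(j))}, which is e_j if π(j) = i and refutable at j otherwise. In the
-- first case H^{(j i)∘π} and H agree at j, in the second they disagree.
module Submission where

open import Defs
open import Data.Nat using (ℕ; _≤_)
open import Data.Fin using (Fin; zero; suc)
open import Data.Fin.Properties using (_≟_)
open import Data.Fin.Permutation.Components using (transpose; transpose-inverse)
open import Data.Vec using (Vec; lookup; tabulate; []; _∷_)
open import Data.Vec.Properties using (lookup∘tabulate; tabulate∘lookup; tabulate-cong)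
open import Data.List using ([_]) renaming ([] to []ˡ; _∷_ to _∷ˡ_)
open import Data.List.Relation.Binary.Permutation.Propositional using (swap; ↭-refl)
open import Data.Product using (_,_)
open import Function using (id)
open import Relation.Nullary using (yes; no)
open import Relation.Nullary.Decidable using (recompute; dec-true; dec-false)
open import Relation.Binary.PropositionalEquality hiding ([_])
open ≡-Reasoning

transpose-matchˡ : ∀ {n} (i j : Fin n) → transpose i j i ≡ j
transpose-matchˡ i j rewrite dec-true (i ≟ i) refl = refl

transpose-matchʳ : ∀ {n} (i j : Fin n) → transpose i j j ≡ i
transpose-matchʳ i j with j ≟ i
... | yes j≡i = j≡i
... | no _ rewrite dec-true (j ≟ j) refl = refl

transpose-self : ∀ {n} (i k : Fin n) → transpose i i k ≡ k
transpose-self i k with k ≟ i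
... | yes k≡i = sym k≡i
... | no k≢i rewrite dec-false (k ≟ i) k≢i = refl

transpose-≡ˡ : ∀ {n} (i j k : Fin n) → transpose j i k ≡ j → k ≡ i
transpose-≡ˡ i j k eq = begin
  k                                ≡⟨ transpose-inverse i j ⟨
  transpose i j (transpose j i k)  ≡⟨ cong (transpose i j) eq ⟩
  transpose i j j                  ≡⟨ transpose-matchʳ i j ⟩
  i                                ∎

module _ {n : ℕ} where

  idₚ : Perm n
  idₚ = perm (tabulate id) (tabulate id)
    (λ k → trans (lookup∘tabulate id _) (lookup∘tabulate id k))
    (λ k → trans (lookup∘tabulate id _) (lookup∘tabulate id k))

  app-idₚ : ∀ k → app idₚ k ≡ k
  app-idₚ = lookup∘tabulate id

  inv-idₚ : ∀ k → inv idₚ k ≡ k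
  inv-idₚ = lookup∘tabulate id

  app-∘ : ∀ (ρ σ : Perm n) k → app (ρ ∘ₚ σ) k ≡ app ρ (app σ k)
  app-∘ (perm _ _ _ _) (perm _ _ _ _) = lookup∘tabulate _

  inv-∘ : ∀ (ρ σ : Perm n) k → inv (ρ ∘ₚ σ) k ≡ inv σ (inv ρ k)
  inv-∘ (perm _ _ _ _) (perm _ _ _ _) = lookup∘tabulate _

  app-tr : ∀ (i j k : Fin n) → app (tr i j) k ≡ transpose i j k
  app-tr i j = lookup∘tabulate (transpose i j)

  inv-tr : ∀ (i j k : Fin n) → inv (tr i j) k ≡ transpose j i k
  inv-tr i j = lookup∘tabulate (transpose j i)

  -- The inverse laws are stored irrelevantly; decidability of ≡ on Fin recovers them.
  inv-app : ∀ (π : Perm n) k → inv π (app π k) ≡ k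
  inv-app (perm t f l _) k = recompute (lookup f (lookup t k) ≟ k) (l k)

  app-inv : ∀ (π : Perm n) k → app π (inv π k) ≡ k
  app-inv (perm t f _ r) k = recompute (lookup t (lookup f k) ≟ k) (r k)

  ≗⇒≡ : ∀ {ρ σ : Perm n} → (∀ k → app ρ k ≡ app σ k) → ρ ≡ σ
  ≗⇒≡ {ρ@(perm ρt ρf _ _)} {σ@(perm σt σf _ _)} app≗ = cong-perm (vec-ext app≗) (vec-ext inv≗)
    where
      vec-ext : ∀ {u v : Vec (Fin n) n} → (∀ k → lookup u k ≡ lookup v k) → u ≡ v
      vec-ext {u} {v} eq = trans (sym (tabulate∘lookup u)) (trans (tabulate-cong eq) (tabulate∘lookup v))

      inv≗ : ∀ k → inv ρ k ≡ inv σ k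
      inv≗ k = begin
        inv ρ k                     ≡⟨ inv-app σ (inv ρ k) ⟨
        inv σ (app σ (inv ρ k))     ≡⟨ cong (inv σ) (app≗ (inv ρ k)) ⟨
        inv σ (app ρ (inv ρ k))     ≡⟨ cong (inv σ) (app-inv ρ k) ⟩
        inv σ k                     ∎

      cong-perm : ∀ {a b c d : Vec (Fin n) n} .{l r l′ r′} →
                  a ≡ c → b ≡ d → perm a b l r ≡ perm c d l′ r′
      cong-perm refl refl = refl

  ∘ₚ-assoc : ∀ (ρ σ π : Perm n) → ρ ∘ₚ (σ ∘ₚ π) ≡ (ρ ∘ₚ σ) ∘ₚ π
  ∘ₚ-assoc ρ σ π = ≗⇒≡ λ k → begin
    app (ρ ∘ₚ (σ ∘ₚ π)) k     ≡⟨ app-∘ ρ (σ ∘ₚ π) k ⟩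
    app ρ (app (σ ∘ₚ π) k)    ≡⟨ cong (app ρ) (app-∘ σ π k) ⟩
    app ρ (app σ (app π k))   ≡⟨ app-∘ ρ σ (app π k) ⟨
    app (ρ ∘ₚ σ) (app π k)    ≡⟨ app-∘ (ρ ∘ₚ σ) π k ⟨
    app ((ρ ∘ₚ σ) ∘ₚ π) k     ∎

  ∘ₚ-identityˡ : ∀ (π : Perm n) → idₚ ∘ₚ π ≡ π
  ∘ₚ-identityˡ π = ≗⇒≡ λ k → trans (app-∘ idₚ π k) (app-idₚ (app π k))

  tr-self : ∀ (i : Fin n) → tr i i ≡ idₚ
  tr-self i = ≗⇒≡ λ k → trans (app-tr i i k) (trans (transpose-self i k) (sym (app-idₚ k)))

  tr-inverse : ∀ (i j : Fin n) → tr i j ∘ₚ tr j i ≡ idₚ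
  tr-inverse i j = ≗⇒≡ λ k → begin
    app (tr i j ∘ₚ tr j i) k          ≡⟨ app-∘ (tr i j) (tr j i) k ⟩
    app (tr i j) (app (tr j i) k)     ≡⟨ app-tr i j _ ⟩
    transpose i j (app (tr j i) k)    ≡⟨ cong (transpose i j) (app-tr j i k) ⟩
    transpose i j (transpose j i k)   ≡⟨ transpose-inverse i j ⟩
    k                                 ≡⟨ app-idₚ k ⟨
    app idₚ k                         ∎

  mutual
    ^-∘ : ∀ (H : Formula n) σ ρ → (H ^ σ) ^ ρ ≡ H ^ (ρ ∘ₚ σ)
    ^-∘ (var X π) σ ρ = cong (var X) (∘ₚ-assoc ρ σ π)
    ^-∘ (e k)     σ ρ = cong e (sym (app-∘ ρ σ k))
    ^-∘ (q F Gs)  σ ρ = cong (q F) (^ᵛ-∘ Gs σ ρ)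

    ^ᵛ-∘ : ∀ {m} (Gs : Vec (Formula n) m) σ ρ → (Gs ^ᵛ σ) ^ᵛ ρ ≡ Gs ^ᵛ (ρ ∘ₚ σ)
    ^ᵛ-∘ []       σ ρ = refl
    ^ᵛ-∘ (G ∷ Gs) σ ρ = cong₂ _∷_ (^-∘ G σ ρ) (^ᵛ-∘ Gs σ ρ)

  mutual
    ^-idₚ : ∀ (H : Formula n) → H ^ idₚ ≡ H
    ^-idₚ (var X π) = cong (var X) (∘ₚ-identityˡ π)
    ^-idₚ (e k)     = cong e (app-idₚ k)
    ^-idₚ (q F Gs)  = cong (q F) (^ᵛ-idₚ Gs)

    ^ᵛ-idₚ : ∀ {m} (Gs : Vec (Formula n) m) → Gs ^ᵛ idₚ ≡ Gs
    ^ᵛ-idₚ []       = refl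
    ^ᵛ-idₚ (G ∷ Gs) = cong₂ _∷_ (^-idₚ G) (^ᵛ-idₚ Gs)

  ^-tr-self : ∀ (H : Formula n) i → H ^ tr i i ≡ H
  ^-tr-self H i = trans (cong (H ^_) (tr-self i)) (^-idₚ H)

  ^-tr-inverse : ∀ (H : Formula n) i j → (H ^ tr j i) ^ tr i j ≡ H
  ^-tr-inverse H i j = trans (^-∘ H (tr j i) (tr i j)) (trans (cong (H ^_) (tr-inverse i j)) (^-idₚ H))

  lookup-^ᵛ : ∀ {m} (Gs : Vec (Formula n) m) ρ j → lookup (Gs ^ᵛ ρ) j ≡ lookup Gs j ^ ρ
  lookup-^ᵛ (G ∷ Gs) ρ zero    = refl
  lookup-^ᵛ (G ∷ Gs) ρ (suc j) = lookup-^ᵛ Gs ρ j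

  e-refute : ∀ {a m : Fin n} → a ≢ m → [ e a ] ⊢[ m ] []ˡ
  e-refute {a} {m} a≢m = subst (λ x → [ e x ] ⊢[ m ] []ˡ) (trans (app-tr m a m) (transpose-matchˡ m a))
    (Neg1 {k = a} {Γ = []ˡ} {Δ = []ˡ} (λ m≡a → a≢m (sym m≡a)) Const)

  q-mono : ∀ {m F} {Gs Gs′ : Vec (Formula n) n} →
           (∀ {l j} → l ≢ j → (F ^ tr l j) ∷ˡ F ∷ˡ []ˡ ⊢[ l ] []ˡ) →
           (∀ j → [ lookup Gs j ^ tr j m ] ⊢[ j ] [ lookup Gs′ j ^ tr j m ]) →
           [ q F Gs ] ⊢[ m ] [ q F Gs′ ]
  q-mono {m} {F} {Gs} {Gs′} refute mono = qR λ j → ExL (swap _ _ ↭-refl) (qL (branch j))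
    where
      branch : ∀ j l → F ∷ˡ (lookup (Gs ^ᵛ tr j m) l ^ tr l j) ∷ˡ (F ^ tr l j) ∷ˡ []ˡ
                       ⊢[ l ] [ (lookup Gs′ j ^ tr j m) ^ tr l j ]
      branch j l with l ≟ j
      ... | yes refl = WL (ExL (swap _ _ ↭-refl) (WL (subst₂ (λ A B → [ A ] ⊢[ j ] [ B ])
                         (sym (trans (^-tr-self _ j) (lookup-^ᵛ Gs (tr j m) j)))
                         (sym (^-tr-self _ j))
                         (mono j))))
      ... | no l≢j   = ExL (swap _ _ ↭-refl) (WL (ExL (swap _ _ ↭-refl) (WR (refute l≢j))))

  mutual
    agree⇒⊢ : ∀ (H : Formula n) σ τ m → inv σ m ≡ inv τ m → [ H ^ σ ] ⊢[ m ] [ H ^ τ ]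
    agree⇒⊢ (var X π) σ τ m eq = Id (begin
      inv (σ ∘ₚ π) m   ≡⟨ inv-∘ σ π m ⟩
      inv π (inv σ m)  ≡⟨ cong (inv π) eq ⟩
      inv π (inv τ m)  ≡⟨ inv-∘ τ π m ⟨
      inv (τ ∘ₚ π) m   ∎)
    agree⇒⊢ (e k) σ τ m eq with app σ k ≟ m
    ... | yes σk≡m = subst₂ (λ a b → [ e a ] ⊢[ m ] [ e b ]) (sym σk≡m) (sym τk≡m) (WL Const)
      where
        τk≡m : app τ k ≡ m
        τk≡m = begin
          app τ k                   ≡⟨ cong (app τ) (inv-app σ k) ⟨
          app τ (inv σ (app σ k))   ≡⟨ cong (λ x → app τ (inv σ x)) σk≡m ⟩
          app τ (inv σ m)           ≡⟨ cong (app τ) eq ⟩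
          app τ (inv τ m)           ≡⟨ app-inv τ m ⟩
          m                         ∎
    ... | no σk≢m  = WR (e-refute σk≢m)
    agree⇒⊢ (q F Gs) σ τ m eq = q-mono refute-F mono
      where
        refute-F : ∀ {l j} → l ≢ j → (F ^ tr l j) ∷ˡ F ∷ˡ []ˡ ⊢[ l ] []ˡ
        refute-F {l} {j} l≢j = subst (λ A → (F ^ tr l j) ∷ˡ A ∷ˡ []ˡ ⊢[ l ] []ˡ) (^-idₚ F)
          (disagree⇒refute F (tr l j) idₚ l (λ eq′ → l≢j (sym (begin
            j                ≡⟨ transpose-matchʳ j l ⟨
            transpose j l l  ≡⟨ inv-tr l j l ⟨
            inv (tr l j) l   ≡⟨ eq′ ⟩
            inv idₚ l        ≡⟨ inv-idₚ l ⟩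
            l                ∎))))

        inv-tr-∘ : ∀ ρ j → inv (tr j m ∘ₚ ρ) j ≡ inv ρ m
        inv-tr-∘ ρ j = trans (inv-∘ (tr j m) ρ j)
                             (cong (inv ρ) (trans (inv-tr j m j) (transpose-matchʳ m j)))

        mono : ∀ j → [ lookup (Gs ^ᵛ σ) j ^ tr j m ] ⊢[ j ] [ lookup (Gs ^ᵛ τ) j ^ tr j m ]
        mono j = subst₂ (λ A B → [ A ] ⊢[ j ] [ B ]) (sym (lookup-^ᵛ-^ σ)) (sym (lookup-^ᵛ-^ τ))
          (agree⇒⊢-lookup Gs j (tr j m ∘ₚ σ) (tr j m ∘ₚ τ) j
            (trans (inv-tr-∘ σ j) (trans eq (sym (inv-tr-∘ τ j)))))
          where
            lookup-^ᵛ-^ : ∀ ρ → lookup (Gs ^ᵛ ρ) j ^ tr j m ≡ lookup Gs j ^ (tr j m ∘ₚ ρ)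
            lookup-^ᵛ-^ ρ = trans (cong (_^ tr j m) (lookup-^ᵛ Gs ρ j)) (^-∘ (lookup Gs j) ρ (tr j m))

    agree⇒⊢-lookup : ∀ {k} (Gs : Vec (Formula n) k) j σ τ m → inv σ m ≡ inv τ m →
                     [ lookup Gs j ^ σ ] ⊢[ m ] [ lookup Gs j ^ τ ]
    agree⇒⊢-lookup (G ∷ Gs) zero    = agree⇒⊢ G
    agree⇒⊢-lookup (G ∷ Gs) (suc j) = agree⇒⊢-lookup Gs j

    -- Neg1 with k = σ(τ⁻¹ m), applied to (H^σ)^{(k m)}, whose (m k)-image is H^σ.
    disagree⇒refute : ∀ (H : Formula n) σ τ m → inv σ m ≢ inv τ m →
                      (H ^ σ) ∷ˡ (H ^ τ) ∷ˡ []ˡ ⊢[ m ] []ˡ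
    disagree⇒refute H σ τ m ne =
      subst (λ A → A ∷ˡ (H ^ τ) ∷ˡ []ˡ ⊢[ m ] []ˡ) (^-tr-inverse (H ^ σ) m k)
        (Neg1 {k = k} {Γ = [ H ^ τ ]} {Δ = []ˡ} m≢k premise)
      where
        k = app σ (inv τ m)

        m≢k : m ≢ k
        m≢k m≡k = ne (trans (cong (inv σ) m≡k) (inv-app σ (inv τ m)))

        premise : [ (H ^ τ) ^ tr m m ] ⊢[ m ] [ (H ^ σ) ^ tr k m ]
        premise = subst₂ (λ A B → [ A ] ⊢[ m ] [ B ]) (sym (^-tr-self (H ^ τ) m)) (sym (^-∘ H σ (tr k m)))
          (agree⇒⊢ H τ (tr k m ∘ₚ σ) m (sym (begin
            inv (tr k m ∘ₚ σ) m       ≡⟨ inv-∘ (tr k m) σ m ⟩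
            inv σ (inv (tr k m) m)    ≡⟨ cong (inv σ) (trans (inv-tr k m m) (transpose-matchˡ m k)) ⟩
            inv σ k                   ≡⟨ inv-app σ (inv τ m) ⟩
            inv τ m                   ∎)))

module _ {n : ℕ} (H : Formula n) (π : Perm n) (i : Fin n) where

  private
    E : Vec (Formula n) n
    E = tabulate (λ k → e (app π k))

  E-entry : ∀ j → lookup E j ^ tr j i ≡ e (transpose j i (app π j))
  E-entry j = trans (cong (_^ tr j i) (lookup∘tabulate (λ k → e (app π k)) j)) (cong e (app-tr j i (app π j)))

  inv-tr-π : ∀ j → inv (tr j i ∘ₚ π) j ≡ inv π i
  inv-tr-π j = trans (inv-∘ (tr j i) π j) (cong (inv π) (trans (inv-tr j i j) (transpose-matchʳ i j)))

  ^⊢q : [ H ^ π ] ⊢[ i ] [ q H E ]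
  ^⊢q = qR branch
    where
      branch : ∀ j → H ∷ˡ ((H ^ π) ^ tr j i) ∷ˡ []ˡ ⊢[ j ] [ lookup E j ^ tr j i ]
      branch j with app π j ≟ i
      ... | yes πj≡i = subst (λ A → H ∷ˡ ((H ^ π) ^ tr j i) ∷ˡ []ˡ ⊢[ j ] [ A ])
                         (sym (trans (E-entry j) (cong e (trans (cong (transpose j i) πj≡i) (transpose-matchʳ j i)))))
                         (WL (WL Const))
      ... | no πj≢i  = ExL (swap _ _ ↭-refl) (WR (subst₂ (λ A B → A ∷ˡ B ∷ˡ []ˡ ⊢[ j ] []ˡ)
                         (sym (^-∘ H π (tr j i))) (^-idₚ H)
                         (disagree⇒refute H (tr j i ∘ₚ π) idₚ j λ eq →
                           πj≢i (begin
                             app π j                      ≡⟨ cong (app π) (inv-idₚ j) ⟨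
                             app π (inv idₚ j)            ≡⟨ cong (app π) eq ⟨
                             app π (inv (tr j i ∘ₚ π) j)  ≡⟨ cong (app π) (inv-tr-π j) ⟩
                             app π (inv π i)              ≡⟨ app-inv π i ⟩
                             i                            ∎))))

  q⊢^ : [ q H E ] ⊢[ i ] [ H ^ π ]
  q⊢^ = qL branch
    where
      branch : ∀ j → H ∷ˡ (lookup E j ^ tr j i) ∷ˡ []ˡ ⊢[ j ] [ (H ^ π) ^ tr j i ]
      branch j with app π j ≟ i
      ... | yes πj≡i = ExL (swap _ _ ↭-refl) (WL (subst₂ (λ A B → [ A ] ⊢[ j ] [ B ])
                         (^-idₚ H) (sym (^-∘ H π (tr j i)))
                         (agree⇒⊢ H idₚ (tr j i ∘ₚ π) j (begin
                           inv idₚ j            ≡⟨ inv-idₚ j ⟩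
                           j                    ≡⟨ inv-app π j ⟨
                           inv π (app π j)      ≡⟨ cong (inv π) πj≡i ⟩
                           inv π i              ≡⟨ inv-tr-π j ⟨
                           inv (tr j i ∘ₚ π) j  ∎))))
      ... | no πj≢i  = WL (WR (subst (λ A → [ A ] ⊢[ j ] []ˡ) (sym (E-entry j))
                         (e-refute (λ eq → πj≢i (transpose-≡ˡ i j (app π j) eq)))))

lemma4p5 : (n : ℕ) → 2 ≤ n → (H : Formula n) (π : Perm n) →
           (H ^ π) ∼ q H (tabulate (λ k → e (app π k)))
lemma4p5 n _ H π i = ^⊢q H π i , q⊢^ H π i
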